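{- Let $(X,\mathcal{T},\{f_\pi\}_{\pi\in\Pi},v)$ be a dynamic topological model in which $f_{\pi_1;\pi_2} = f_{\pi_2}\circ f_{\pi_1}$ for the programs $\pi_1,\pi_2,\pi_1;\pi_2 \in \Pi$. If $f_{\pi_1}$ is an open map, then for every formula $\phi \in \mathcal{L}_{PDL}$, $\llbracket \langle \pi_1;\pi_2\rangle\phi\rrbracket = \llbracket \langle\pi_1\rangle\langle\pi_2\rangle\phi\rrbracket$.
   Context: Fix a countable set $\textsc{prop}$ of primitive propositions and a set $\Pi$ of programs closed under sequencing: if $\pi_1,\pi_2 \in \Pi$ then $\pi_1;\pi_2 \in \Pi$. The language $\mathcal{L}_{PDL}$ is $\phi ::= p \mid \neg\phi \mid \phi \wedge \psi \mid \langle \pi \rangle \phi$ with $p \in \textsc{prop}$, $\pi \in \Pi$. A dynamic topological model is a tuple $(X,\mathcal{T},\{f_\pi\}_{\pi\in\Pi},v)$ where $(X,\mathcal{T})$ is a topological space, each $f_\pi : X \to X$ is a total function (not required to be continuous), and $v : \textsc{prop} \to 2^X$. Truth: $x \models p$ iff $x \in v(p)$; Boolean connectives as usual; $x \models \langle\pi\rangle\phi$ iff $x \in \mathrm{cl}(f_\pi^{ -1}(\llbracket\phi\rrbracket))$, where $\llbracket\phi\rrbracket = \{y \in X : y \models \phi\}$. A function $f$ is open if $f(U)$ is open for every open $U$. -}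

module Defs where

open import Level using (0ℓ)
open import Data.Nat using (ℕ)
open import Data.Product using (Σ; ∃; _×_)
open import Relation.Nullary using (¬_)
open import Relation.Unary using (Pred; _∈_; _∩_; _⊆_; _≐_; U; ⋃)
open import Relation.Binary.PropositionalEquality using (_≡_)

-- The family of open sets is given as a
-- (small) indexed family  ⌜_⌝ : Opn → Pred X 0ℓ  (so that closure stays in Set),
-- closed under the whole space, binary intersections and arbitrary unions.
record Topology (X : Set) : Set₁ where
  field
    Opn      : Set
    ⌜_⌝      : Opn → Pred X 0ℓ
    open-univ : ∃ λ (O : Opn) → ⌜ O ⌝ ≐ U
    open-∩   : ∀ (A B : Opn) → ∃ λ (O : Opn) → ⌜ O ⌝ ≐ (⌜ A ⌝ ∩ ⌜ B ⌝)
    open-⋃   : (I : Set) (F : I → Opn) → ∃ λ (O : Opn) → ⌜ O ⌝ ≐ ⋃ I (λ i → ⌜ F i ⌝)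

  Open : Pred X 0ℓ → Set
  Open A = ∃ λ (O : Opn) → ⌜ O ⌝ ≐ A

  cl : Pred X 0ℓ → Pred X 0ℓ
  cl A x = ∀ (V : Opn) → x ∈ ⌜ V ⌝ → ∃ λ y → y ∈ ⌜ V ⌝ × y ∈ A

preimage : {X : Set} → (X → X) → Pred X 0ℓ → Pred X 0ℓ
preimage f A x = f x ∈ A

image : {X : Set} → (X → X) → Pred X 0ℓ → Pred X 0ℓ
image f A y = ∃ λ x → x ∈ A × f x ≡ y

IsOpenMap : {X : Set} → Topology X → (X → X) → Set
IsOpenMap T f = ∀ (O : Topology.Opn T) → Topology.Open T (image f (Topology.⌜_⌝ T O))

record Programs : Set₁ where
  field
    Prog : Set
    _⨾_  : Prog → Prog → Prog

data Formula (P : Set) : Set where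
  var  : ℕ → Formula P
  ¬'_  : Formula P → Formula P
  _∧'_ : Formula P → Formula P → Formula P
  ⟨_⟩_ : P → Formula P → Formula P

record DTModel (P : Set) : Set₁ where
  field
    X   : Set
    top : Topology X
    f   : P → X → X
    v   : ℕ → Pred X 0ℓ

  open Topology top public

  ⟦_⟧ : Formula P → Pred X 0ℓ
  ⟦ var p ⟧ = v p
  ⟦ ¬' φ ⟧ x = ¬ (x ∈ ⟦ φ ⟧)
  ⟦ φ ∧' ψ ⟧ x = x ∈ ⟦ φ ⟧ × x ∈ ⟦ ψ ⟧
  ⟦ ⟨ π ⟩ φ ⟧ = cl (preimage (f π) ⟦ φ ⟧)

-- Since f (π₁ ⨾ π₂) = f π₂ ∘ f π₁, the left side is cl (f₁⁻¹ f₂⁻¹ A); it is contained in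
-- cl (f₁⁻¹ cl (f₂⁻¹ A)) since cl is monotone and inflationary.
-- Conversely, for an open map f₁ a point of f₁⁻¹ (cl B) lies in cl (f₁⁻¹ B): the image
-- of any neighbourhood V of it is a neighbourhood of its image, hence meets B at
-- the image of some point of V.  Idempotence of cl then gives the reverse inclusion.
module Submission where

open import Level using (0ℓ)
open import Data.Product using (_,_; proj₁; proj₂)
open import Function using (_∘_)
open import Relation.Unary using (Pred; _⊆_; _≐_)
open import Relation.Binary.PropositionalEquality using (_≡_; refl; subst; sym)

open import Defs

module _ {X : Set} (T : Topology X) where
  open Topology T

  cl-mono : {A B : Pred X 0ℓ} → A ⊆ B → cl A ⊆ cl B
  cl-mono A⊆B x∈clA V x∈V with x∈clA V x∈V
  ... | y , y∈V , y∈A = y , y∈V , A⊆B y∈A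

  ⊆-cl : {A : Pred X 0ℓ} → A ⊆ cl A
  ⊆-cl {x = x} x∈A V x∈V = x , x∈V , x∈A

  cl-idem : {A : Pred X 0ℓ} → cl (cl A) ⊆ cl A
  cl-idem x∈clclA V x∈V with x∈clclA V x∈V
  ... | y , y∈V , y∈clA = y∈clA V y∈V

  preimage-cl-⊆-cl-preimage : {g : X → X} → IsOpenMap T g →
    {B : Pred X 0ℓ} → preimage g (cl B) ⊆ cl (preimage g B)
  preimage-cl-⊆-cl-preimage {g} g-open gy∈clB V y∈V with g-open V
  ... | O , O≐gV with gy∈clB O (proj₂ O≐gV (_ , y∈V , refl))
  ... | z , z∈O , z∈B with proj₁ O≐gV z∈O
  ... | w , w∈V , refl = w , w∈V , z∈B

  cl-preimage-cl≐cl-preimage : {g : X → X} → IsOpenMap T g →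
    {B : Pred X 0ℓ} → cl (preimage g (cl B)) ≐ cl (preimage g B)
  cl-preimage-cl≐cl-preimage g-open =
    cl-idem ∘ cl-mono (preimage-cl-⊆-cl-preimage g-open) ,
    cl-mono ⊆-cl

preimage-≗ : {X : Set} {g h : X → X} → (∀ x → g x ≡ h x) →
  (A : Pred X 0ℓ) → preimage g A ≐ preimage h A
preimage-≗ g≗h A = (λ {x} → subst A (g≗h x)) , (λ {x} → subst A (sym (g≗h x)))

lemma1 : (Π : Programs) → let open Programs Π in
    (M : DTModel Prog) → let open DTModel M in
    (π₁ π₂ : Prog) →
    (∀ x → f (π₁ ⨾ π₂) x ≡ f π₂ (f π₁ x)) →
    IsOpenMap top (f π₁) →
    (φ : Formula Prog) →
    ⟦ ⟨ π₁ ⨾ π₂ ⟩ φ ⟧ ≐ ⟦ ⟨ π₁ ⟩ (⟨ π₂ ⟩ φ) ⟧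
lemma1 Π M π₁ π₂ f-⨾ f₁-open φ =
  proj₂ cl-equiv ∘ cl-mono top (proj₁ sequence) ,
  cl-mono top (proj₂ sequence) ∘ proj₁ cl-equiv
  where
  open Programs Π
  open DTModel M
  sequence : preimage (f (π₁ ⨾ π₂)) ⟦ φ ⟧ ≐ preimage (f π₁) (preimage (f π₂) ⟦ φ ⟧)
  sequence = preimage-≗ f-⨾ ⟦ φ ⟧

  cl-equiv : cl (preimage (f π₁) ⟦ ⟨ π₂ ⟩ φ ⟧) ≐ cl (preimage (f π₁) (preimage (f π₂) ⟦ φ ⟧))
  cl-equiv = cl-preimage-cl≐cl-preimage top f₁-open
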